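{- There exists an aperiodic recurrent infinite word that avoids $6$-anti-powers.
   Context: A $6$-anti-power is a word $u_1\cdots u_6$ with $u_1,\ldots,u_6$ non-empty words of the same length that are pairwise distinct. An infinite word avoids $6$-anti-powers if none of its factors is a $6$-anti-power. An infinite word is recurrent if every finite factor occurs infinitely often; aperiodic if it is not of the form $vu^\omega$ with $v$ finite and $u$ finite non-empty. -}

module Defs where

open import Data.Nat using (ℕ; suc; _+_; _*_; _≤_; _<_)
open import Data.Fin using (Fin; toℕ)
open import Data.Product using (Σ; ∃; _×_; _,_)
open import Relation.Binary.PropositionalEquality using (_≡_; _≢_)
open import Relation.Nullary using (¬_)

Word : Set → Set
Word A = ℕ → A

BlocksDiffer : {A : Set} → Word A → (m p q : ℕ) → Set
BlocksDiffer w m p q = Σ ℕ λ t → (t < m) × (w (p + t) ≢ w (q + t))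

AntiPowerAt : {A : Set} → (k : ℕ) → Word A → (i m : ℕ) → Set
AntiPowerAt k w i m =
  (1 ≤ m) ×
  ((a b : Fin k) → toℕ a < toℕ b →
     BlocksDiffer w m (i + toℕ a * m) (i + toℕ b * m))

AvoidsAntiPowers : {A : Set} → ℕ → Word A → Set
AvoidsAntiPowers k w = (i m : ℕ) → ¬ AntiPowerAt k w i m

Recurrent : {A : Set} → Word A → Set
Recurrent w = (i n N : ℕ) →
  Σ ℕ λ j → (N < j) × ((t : ℕ) → t < n → w (j + t) ≡ w (i + t))

-- Ultimately periodic: w = v u^ω with u non-empty, i.e. there are p ≥ 1 and N
-- with w (n + p) = w n for all n ≥ N.
UltimatelyPeriodic : {A : Set} → Word A → Set
UltimatelyPeriodic w =
  Σ ℕ λ p → Σ ℕ λ N → (1 ≤ p) × ((n : ℕ) → N ≤ n → w (n + p) ≡ w n)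

Aperiodic : {A : Set} → Word A → Set
Aperiodic w = ¬ UltimatelyPeriodic w

-- Let w x = 1 exactly when every base-16 digit of x is 0 or 1. The prefix of length 16 ^ K
-- reappears at 16 ^ K, which gives recurrence, and w vanishes on [2·16 ^ K, 3·16 ^ K), a zero
-- run longer than any period, which gives aperiodicity. The ones are so sparse that those in a
-- window of six blocks of length m lie in two intervals of length m; each interval meets at most
-- two blocks, so two blocks are entirely zero, hence equal, and the window is no anti-power.

module Submission where

open import Defs
open import Data.Bool using (Bool; true; false; _∧_)
open import Data.Bool.Properties using (∧-assoc; ∧-zeroʳ; ∧-identityʳ; T-≡; ¬-not)
open import Data.Fin using (Fin; zero; suc; toℕ; fromℕ<)
open import Data.Fin.Properties using (all?; any?; toℕ-fromℕ<; toℕ<n)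
open import Data.Nat
open import Data.Nat.DivMod
open import Data.Nat.Divisibility using (n∣m*n)
open import Data.Nat.Properties
open import Algebra.Properties.CommutativeSemigroup +-commutativeSemigroup
  using (x∙yz≈xz∙y; xy∙z≈xz∙y)
open import Data.Nat.Solver using (module +-*-Solver)
open import Data.Product using (Σ; _×_; _,_; proj₁; proj₂)
open import Data.Sum using (_⊎_; inj₁; inj₂)
open import Data.Unit using (tt)
open import Function using (_∘_)
open import Function.Bundles using (Equivalence)
open import Relation.Binary.PropositionalEquality
open import Relation.Nullary using (¬_; Dec; yes; no; ¬?)
open import Relation.Nullary.Decidable using (toWitness; _×-dec_; _⊎-dec_)

open +-*-Solver using (solve; _:+_; _:*_; _:=_; con)

[r+q*n]/n≡q : ∀ {r n} q .{{_ : NonZero n}} → r < n → (r + q * n) / n ≡ q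
[r+q*n]/n≡q {r} {n} q r<n = begin
  (r + q * n) / n   ≡⟨ +-distrib-/-∣ʳ r (n∣m*n q) ⟩
  r / n + q * n / n ≡⟨ cong₂ _+_ (m<n⇒m/n≡0 r<n) (m*n/n≡m q n) ⟩
  q                 ∎
  where open ≡-Reasoning

[r+q*n]%n≡r : ∀ {r n} q .{{_ : NonZero n}} → r < n → (r + q * n) % n ≡ r
[r+q*n]%n≡r {r} {n} q r<n = trans ([m+kn]%n≡m%n r q n) (m<n⇒m%n≡m r<n)

/-unique : ∀ {x q n} .{{_ : NonZero n}} → q * n ≤ x → x < suc q * n → x / n ≡ q
/-unique {x} {q} {n} lo hi = ≤-antisym
  (s≤s⁻¹ (m<n*o⇒m/o<n hi))
  (subst (_≤ x / n) (m*n/n≡m q n) (/-monoˡ-≤ n lo))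

power-bracket : ∀ b → 1 < b → ∀ n → 1 ≤ n → Σ ℕ λ K → b ^ K ≤ n × n < b ^ suc K
power-bracket b 1<b (suc zero)    _ = 0 , ≤-refl , subst (1 <_) (sym (*-identityʳ b)) 1<b
power-bracket b 1<b (suc (suc n)) _ with power-bracket b 1<b (suc n) (s≤s z≤n)
... | K , lo , hi with suc (suc n) <? b ^ suc K
...   | yes n<bK = K , m≤n⇒m≤1+n lo , n<bK
...   | no  n≮bK = suc K , ≮⇒≥ n≮bK , ≤-<-trans hi (^-monoʳ-< b 1<b (n<1+n (suc K)))

power-above : ∀ n → Σ ℕ λ K → n < 16 ^ K
power-above n with power-bracket 16 (s≤s (s≤s z≤n)) (suc n) (s≤s z≤n)
... | K , _ , n<16K = suc K , <-trans (n<1+n n) n<16K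

periodic-iterate : ∀ {A : Set} {w : Word A} {p N} → (∀ n → N ≤ n → w (n + p) ≡ w n) →
  ∀ c {n} → N ≤ n → w (n + c * p) ≡ w n
periodic-iterate {w = w}         per zero    {n} _   = cong w (+-identityʳ n)
periodic-iterate {w = w} {p} {N} per (suc c) {n} N≤n = begin
  w (n + (p + c * p)) ≡⟨ cong w (x∙yz≈xz∙y n p (c * p)) ⟩
  w (n + c * p + p)   ≡⟨ per (n + c * p) (≤-trans N≤n (m≤m+n n (c * p))) ⟩
  w (n + c * p)       ≡⟨ periodic-iterate per c N≤n ⟩
  w n                 ∎
  where open ≡-Reasoning

periodic-window⇒constant : ∀ {A : Set} {w : Word A} {p N s} {a : A} .{{_ : NonZero p}} →
  (∀ n → N ≤ n → w (n + p) ≡ w n) → N ≤ s → (∀ t → t < p → w (s + t) ≡ a) →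
  ∀ n → s ≤ n → w n ≡ a
periodic-window⇒constant {w = w} {p} {N} {s} {a} per N≤s window n s≤n = begin
  w n                     ≡⟨ cong w n≡ ⟩
  w (s + r + c * p)       ≡⟨ periodic-iterate per c (≤-trans N≤s (m≤m+n s r)) ⟩
  w (s + r)               ≡⟨ window r (m%n<n (n ∸ s) p) ⟩
  a                       ∎
  where
  open ≡-Reasoning
  r = (n ∸ s) % p
  c = (n ∸ s) / p
  n≡ : n ≡ s + r + c * p
  n≡ = trans (sym (m+[n∸m]≡n s≤n))
    (trans (cong (s +_) (m≡m%n+[m/n]*n (n ∸ s) p)) (sym (+-assoc s r (c * p))))

-- The digit test runs with fuel; fuel x suffices, since the quotient by 16 strictly decreases.
digits≤1-fuel : ℕ → ℕ → Bool
digits≤1-fuel zero    x = true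
digits≤1-fuel (suc f) x = (x % 16 ≤ᵇ 1) ∧ digits≤1-fuel f (x / 16)

digits≤1 : ℕ → Bool
digits≤1 x = digits≤1-fuel x x

x≤1+f⇒x/16≤f : ∀ {x f} → x ≤ suc f → x / 16 ≤ f
x≤1+f⇒x/16≤f {zero}      _   = z≤n
x≤1+f⇒x/16≤f {x@(suc _)} x≤f = s≤s⁻¹ (≤-trans (m/n<m x 16 (s≤s (s≤s z≤n))) x≤f)

digits≤1-fuel-suc : ∀ f x → x ≤ f → digits≤1-fuel (suc f) x ≡ digits≤1-fuel f x
digits≤1-fuel-suc zero    zero _   = refl
digits≤1-fuel-suc (suc f) x    x≤f =
  cong ((x % 16 ≤ᵇ 1) ∧_) (digits≤1-fuel-suc f (x / 16) (x≤1+f⇒x/16≤f x≤f))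

digits≤1-fuel-+ : ∀ d x → digits≤1-fuel (d + x) x ≡ digits≤1 x
digits≤1-fuel-+ zero    x = refl
digits≤1-fuel-+ (suc d) x =
  trans (digits≤1-fuel-suc (d + x) x (m≤n+m x d)) (digits≤1-fuel-+ d x)

digits≤1-fuel-enough : ∀ {f x} → x ≤ f → digits≤1-fuel f x ≡ digits≤1 x
digits≤1-fuel-enough {f} {x} x≤f =
  subst (λ g → digits≤1-fuel g x ≡ digits≤1 x) (m∸n+n≡m x≤f) (digits≤1-fuel-+ (f ∸ x) x)

digits≤1-unfold : ∀ x → digits≤1 x ≡ (x % 16 ≤ᵇ 1) ∧ digits≤1 (x / 16)
digits≤1-unfold zero    = refl
digits≤1-unfold (suc n) =
  cong ((suc n % 16 ≤ᵇ 1) ∧_) (digits≤1-fuel-enough (x≤1+f⇒x/16≤f {suc n} ≤-refl))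

digits≤1-digit : ∀ {d} q → d < 16 → digits≤1 (d + q * 16) ≡ (d ≤ᵇ 1) ∧ digits≤1 q
digits≤1-digit {d} q d<16 = trans (digits≤1-unfold (d + q * 16))
  (cong₂ (λ e r → (e ≤ᵇ 1) ∧ digits≤1 r) ([r+q*n]%n≡r q d<16) ([r+q*n]/n≡q q d<16))

digits≤1-concat : ∀ K {r} y → r < 16 ^ K →
  digits≤1 (r + y * 16 ^ K) ≡ digits≤1 r ∧ digits≤1 y
digits≤1-concat zero    {zero} y _ = cong digits≤1 (*-identityʳ y)
digits≤1-concat zero    {suc _} y (s≤s ())
digits≤1-concat (suc K) {r}    y r<16P = begin
  digits≤1 (r + y * 16 ^ suc K)             ≡⟨ cong digits≤1 regroup ⟩
  digits≤1 (d + (q + y * P) * 16)           ≡⟨ digits≤1-digit (q + y * P) (m%n<n r 16) ⟩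
  (d ≤ᵇ 1) ∧ digits≤1 (q + y * P)           ≡⟨ cong ((d ≤ᵇ 1) ∧_) (digits≤1-concat K y q<P) ⟩
  (d ≤ᵇ 1) ∧ (digits≤1 q ∧ digits≤1 y)      ≡⟨ ∧-assoc (d ≤ᵇ 1) (digits≤1 q) (digits≤1 y) ⟨
  ((d ≤ᵇ 1) ∧ digits≤1 q) ∧ digits≤1 y      ≡⟨ cong (_∧ digits≤1 y) (digits≤1-unfold r) ⟨
  digits≤1 r ∧ digits≤1 y                   ∎
  where
  open ≡-Reasoning
  P = 16 ^ K
  d = r % 16
  q = r / 16
  q<P : q < P
  q<P = m<n*o⇒m/o<n (subst (r <_) (*-comm 16 P) r<16P)
  regroup : r + y * (16 * P) ≡ d + (q + y * P) * 16
  regroup = trans (cong (_+ y * (16 * P)) (m≡m%n+[m/n]*n r 16))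
    (solve 4 (λ d q y p → d :+ q :* con 16 :+ y :* (con 16 :* p) := d :+ (q :+ y :* p) :* con 16)
      refl d q y P)

∧≡true⇒ : ∀ {a b} → a ∧ b ≡ true → a ≡ true × b ≡ true
∧≡true⇒ {true} {true} _ = refl , refl

digits≤1-shift : ∀ K {r} → r < 16 ^ K → digits≤1 (r + 16 ^ K) ≡ digits≤1 r
digits≤1-shift K {r} r<P = begin
  digits≤1 (r + 16 ^ K)     ≡⟨ cong (λ z → digits≤1 (r + z)) (*-identityˡ (16 ^ K)) ⟨
  digits≤1 (r + 1 * 16 ^ K) ≡⟨ digits≤1-concat K 1 r<P ⟩
  digits≤1 r ∧ true         ≡⟨ ∧-identityʳ (digits≤1 r) ⟩
  digits≤1 r                ∎
  where open ≡-Reasoning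

digits≤1-gap : ∀ K {r} → r < 16 ^ K → digits≤1 (r + 2 * 16 ^ K) ≡ false
digits≤1-gap K {r} r<P = trans (digits≤1-concat K 2 r<P) (∧-zeroʳ (digits≤1 r))

digits≤1-power : ∀ K → digits≤1 (16 ^ K) ≡ true
digits≤1-power K = trans (cong digits≤1 (sym (*-identityˡ (16 ^ K))))
  (digits≤1-concat K 1 (m^n>0 16 K))

digits≤1-split : ∀ K .{{_ : NonZero (16 ^ K)}} {x} → digits≤1 x ≡ true →
  digits≤1 (x % 16 ^ K) ≡ true × digits≤1 (x / 16 ^ K) ≡ true
digits≤1-split K {x} ones = ∧≡true⇒ (begin
  digits≤1 (x % P) ∧ digits≤1 (x / P) ≡⟨ digits≤1-concat K (x / P) (m%n<n x P) ⟨
  digits≤1 (x % P + x / P * P)        ≡⟨ cong digits≤1 (m≡m%n+[m/n]*n x P) ⟨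
  digits≤1 x                          ≡⟨ ones ⟩
  true                                ∎)
  where
  open ≡-Reasoning
  P = 16 ^ K

digits≤1⇒last≤1 : ∀ x → digits≤1 x ≡ true → x % 16 ≤ 1 × digits≤1 (x / 16) ≡ true
digits≤1⇒last≤1 x ones with ∧≡true⇒ (trans (sym (digits≤1-unfold x)) ones)
... | last≤1 , rest = ≤ᵇ⇒≤ (x % 16) 1 (Equivalence.from T-≡ last≤1) , rest

-- The largest such number below 16 ^ K is 1…1 in base 16, that is (16 ^ K - 1) / 15.
digits≤1-small : ∀ K {r} → digits≤1 r ≡ true → r < 16 ^ K → 15 * r < 16 ^ K
digits≤1-small zero    {zero}  _    _     = s≤s z≤n
digits≤1-small zero    {suc _} _    (s≤s ())
digits≤1-small (suc K) {r}     ones r<16P = begin-strict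
  15 * r                     ≡⟨ cong (15 *_) (m≡m%n+[m/n]*n r 16) ⟩
  15 * (d + q * 16)          ≡⟨ solve 2 (λ d q → con 15 :* (d :+ q :* con 16) := con 15 :* d :+ (con 15 :* q) :* con 16) refl d q ⟩
  15 * d + 15 * q * 16       ≤⟨ +-monoˡ-≤ (15 * q * 16) (*-monoʳ-≤ 15 (proj₁ (digits≤1⇒last≤1 r ones))) ⟩
  15 + 15 * q * 16           <⟨ +-monoˡ-< (15 * q * 16) (n<1+n 15) ⟩
  suc (15 * q) * 16          ≤⟨ *-monoˡ-≤ 16 (digits≤1-small K (proj₂ (digits≤1⇒last≤1 r ones)) q<P) ⟩
  16 ^ K * 16                ≡⟨ *-comm (16 ^ K) 16 ⟩
  16 ^ suc K                 ∎
  where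
  open ≤-Reasoning
  d = r % 16
  q = r / 16
  q<P : q < 16 ^ K
  q<P = m<n*o⇒m/o<n (subst (r <_) (*-comm 16 (16 ^ K)) r<16P)

Within : ℕ → ℕ → ℕ → Set
Within p m x = p ≤ x × x < p + m

Covers : ℕ → ℕ → Set
Covers g a = a ≡ g ⊎ a ≡ suc g

≤≤suc⇒Covers : ∀ {a b} → a ≤ b → b ≤ suc a → Covers a b
≤≤suc⇒Covers a≤b b≤1+a with m≤n⇒m<n∨m≡n a≤b
... | inj₁ a<b = inj₂ (≤-antisym b≤1+a a<b)
... | inj₂ a≡b = inj₁ (sym a≡b)

Within⇒Covers : ∀ {i m p x} .{{_ : NonZero m}} → i ≤ x → Within p m x →
  Covers ((p ∸ i) / m) ((x ∸ i) / m)
Within⇒Covers {i} {m} {p} {x} i≤x (p≤x , x<p+m) =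
  ≤≤suc⇒Covers (/-monoˡ-≤ m (∸-monoˡ-≤ i p≤x)) (begin
    (x ∸ i) / m           ≤⟨ /-monoˡ-≤ m (m≤n+o⇒m∸n≤o x i x≤i+u+m) ⟩
    (u + m) / m           ≡⟨ m/n≡1+[m∸n]/n (m≤n+m m u) ⟩
    suc ((u + m ∸ m) / m) ≡⟨ cong (λ z → suc (z / m)) (m+n∸n≡m u m) ⟩
    suc (u / m)           ∎)
  where
  open ≤-Reasoning
  u = p ∸ i
  x≤i+u+m : x ≤ i + (u + m)
  x≤i+u+m = ≤-trans (<⇒≤ x<p+m)
    (≤-trans (+-monoˡ-≤ m (m≤n+m∸n p i)) (≤-reflexive (+-assoc i u m)))

block-index : ∀ {i m t} a .{{_ : NonZero m}} → t < m → (i + a * m + t ∸ i) / m ≡ a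
block-index {i} {m} {t} a t<m = trans (cong (_/ m) offset) ([r+q*n]/n≡q a t<m)
  where
  offset : i + a * m + t ∸ i ≡ t + a * m
  offset = trans (cong (_∸ i) (+-assoc i (a * m) t))
    (trans (m+n∸m≡n i (a * m + t)) (+-comm (a * m) t))

Uncovered : ℕ → ℕ → ℕ → Set
Uncovered g₁ g₂ a = ¬ Covers g₁ a × ¬ Covers g₂ a

TwoUncoveredBlocks : ℕ → ℕ → Set
TwoUncoveredBlocks g₁ g₂ = Σ (Fin 6) λ a → Σ (Fin 6) λ b →
  toℕ a < toℕ b × Uncovered g₁ g₂ (toℕ a) × Uncovered g₁ g₂ (toℕ b)

covers? : ∀ g a → Dec (Covers g a)
covers? g a = a ≟ g ⊎-dec a ≟ suc g

uncovered? : ∀ g₁ g₂ a → Dec (Uncovered g₁ g₂ a)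
uncovered? g₁ g₂ a = ¬? (covers? g₁ a) ×-dec ¬? (covers? g₂ a)

twoUncoveredBlocks? : ∀ g₁ g₂ → Dec (TwoUncoveredBlocks g₁ g₂)
twoUncoveredBlocks? g₁ g₂ = any? λ a → any? λ b →
  toℕ a <? toℕ b ×-dec uncovered? g₁ g₂ (toℕ a) ×-dec uncovered? g₁ g₂ (toℕ b)

-- Opaque: otherwise a with-abstraction over it normalises the exhaustive search.
opaque
  twoUncoveredBlocks-≤6 : (g₁ g₂ : Fin 7) → TwoUncoveredBlocks (toℕ g₁) (toℕ g₂)
  twoUncoveredBlocks-≤6 = toWitness
    {a? = all? λ g₁ → all? λ g₂ → twoUncoveredBlocks? (toℕ g₁) (toℕ g₂)} tt

Covers⇒≤ : ∀ {g a} → Covers g a → g ≤ a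
Covers⇒≤     (inj₁ refl) = ≤-refl
Covers⇒≤ {g} (inj₂ refl) = n≤1+n g

min6 : ℕ → Fin 7
min6 g = fromℕ< (s≤s (m⊓n≤n g 6))

-- For g ≥ 6 the blocks g and g + 1 lie beyond block 5, just like blocks 6 and 7.
Covers-min6 : ∀ {g a} → a < 6 → Covers g a → Covers (toℕ (min6 g)) a
Covers-min6 {g} {a} a<6 c = subst (λ h → Covers h a) (sym g≡min6) c
  where
  g≡min6 : toℕ (min6 g) ≡ g
  g≡min6 = trans (toℕ-fromℕ< (s≤s (m⊓n≤n g 6))) (m≤n⇒m⊓n≡m (<⇒≤ (≤-<-trans (Covers⇒≤ c) a<6)))

twoUncoveredBlocks : ∀ g₁ g₂ → TwoUncoveredBlocks g₁ g₂
twoUncoveredBlocks g₁ g₂ = unclampBoth (twoUncoveredBlocks-≤6 (min6 g₁) (min6 g₂))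
  where
  unclamp : ∀ a → Uncovered (toℕ (min6 g₁)) (toℕ (min6 g₂)) (toℕ a) → Uncovered g₁ g₂ (toℕ a)
  unclamp a (free₁ , free₂) = free₁ ∘ Covers-min6 (toℕ<n a) , free₂ ∘ Covers-min6 (toℕ<n a)
  unclampBoth : TwoUncoveredBlocks (toℕ (min6 g₁)) (toℕ (min6 g₂)) → TwoUncoveredBlocks g₁ g₂
  unclampBoth (a , b , a<b , free-a , free-b) = a , b , a<b , unclamp a free-a , unclamp b free-b

digit≤1⇒/16≡ : ∀ {y q} → y % 16 ≤ 1 → q ≤ y → y ≤ q + 14 → y / 16 ≡ (q + 14) / 16
digit≤1⇒/16≡ {y} {q} last≤1 q≤y y≤q+14 = sym (/-unique
  (≤-trans (m/n*n≤m y 16) y≤q+14)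
  (begin-strict
    q + 14                   ≤⟨ +-monoˡ-≤ 14 q≤y ⟩
    y + 14                   ≡⟨ cong (_+ 14) (m≡m%n+[m/n]*n y 16) ⟩
    y % 16 + Y16 + 14        ≡⟨ solve 2 (λ d a → d :+ a :+ con 14 := d :+ con 14 :+ a) refl (y % 16) Y16 ⟩
    y % 16 + 14 + Y16        ≤⟨ +-monoˡ-≤ Y16 (+-monoˡ-≤ 14 last≤1) ⟩
    15 + Y16                 <⟨ n<1+n (15 + Y16) ⟩
    suc (y / 16) * 16        ∎))
  where
  open ≤-Reasoning
  Y16 = y / 16 * 16

6m<7P : ∀ {m P} → 15 * m < 16 * P → 6 * m < 7 * P
6m<7P {m} {P} 15m<16P = *-cancelˡ-< 15 (6 * m) (7 * P) (begin-strict
  15 * (6 * m) ≡⟨ solve 1 (λ m → con 15 :* (con 6 :* m) := con 6 :* (con 15 :* m)) refl m ⟩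
  6 * (15 * m) <⟨ *-monoʳ-< 6 15m<16P ⟩
  6 * (16 * P) ≤⟨ ≤-reflexive (solve 1 (λ P → con 6 :* (con 16 :* P) := con 96 :* P) refl P) ⟩
  96 * P       ≤⟨ *-monoˡ-≤ P (≤ᵇ⇒≤ 96 105 tt) ⟩
  105 * P      ≡⟨ solve 1 (λ P → con 105 :* P := con 15 :* (con 7 :* P)) refl P ⟩
  15 * (7 * P) ∎)
  where open ≤-Reasoning

Within-+ : ∀ {p m r} → r < m → Within p m (r + p)
Within-+ {p} {m} {r} r<m = m≤n+m p r , subst (_< p + m) (+-comm p r) (+-monoʳ-< p r<m)

≤1-elim : ∀ {A : ℕ → Set} d → d ≤ 1 → A d → A 0 ⊎ A 1
≤1-elim zero          _        a = inj₁ a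
≤1-elim (suc zero)    _        a = inj₂ a
≤1-elim (suc (suc _)) (s≤s ()) _

OnesWithin : ℕ → ℕ → ℕ → ℕ → Set
OnesWithin i m p₁ p₂ =
  ∀ x → i ≤ x → x < i + 6 * m → digits≤1 x ≡ true → Within p₁ m x ⊎ Within p₂ m x

-- With 16 ^ K ≤ 15 m < 16 ^ (K + 1), a one x = r + y 16 ^ K (r < 16 ^ K) has r < m, and the window
-- pins y to eight consecutive values, of which only 16 Y and 16 Y + 1 can end in digit 0 or 1.
ones-in-two-intervals : ∀ i m → 1 ≤ m → Σ ℕ λ p₁ → Σ ℕ λ p₂ → OnesWithin i m p₁ p₂
ones-in-two-intervals i m 1≤m
  with power-bracket 16 (s≤s (s≤s z≤n)) (15 * m) (≤-trans (s≤s z≤n) (*-monoʳ-≤ 15 1≤m))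
... | K , P≤15m , 15m<16P = base 0 , base 1 , cluster
  where
  P = 16 ^ K
  instance
    P≢0 : NonZero P
    P≢0 = m^n≢0 16 K
  q = i / P
  base : ℕ → ℕ
  base d = (d + (q + 14) / 16 * 16) * P

  cluster : OnesWithin i m (base 0) (base 1)
  cluster x i≤x x<i+6m ones =
    ≤1-elim {λ d → Within (base d) m x} (y % 16) last≤1
      (subst (Within (base (y % 16)) m) (sym x≡) (Within-+ r<m))
    where
    r = x % P
    y = x / P
    r<m : r < m
    r<m = *-cancelˡ-< 15 r m
      (<-≤-trans (digits≤1-small K (proj₁ (digits≤1-split K ones)) (m%n<n x P)) P≤15m)
    last≤1 : y % 16 ≤ 1
    last≤1 = proj₁ (digits≤1⇒last≤1 y (proj₂ (digits≤1-split K ones)))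
    y≤q+7 : y ≤ q + 7
    y≤q+7 = begin
      y               ≤⟨ /-monoˡ-≤ P (≤-trans (<⇒≤ x<i+6m) (+-monoʳ-≤ i (<⇒≤ (6m<7P {m} {P} 15m<16P)))) ⟩
      (i + 7 * P) / P ≡⟨ +-distrib-/-∣ʳ i (n∣m*n 7) ⟩
      q + 7 * P / P   ≡⟨ cong (q +_) (m*n/n≡m 7 P) ⟩
      q + 7           ∎
      where open ≤-Reasoning
    y/16≡ : y / 16 ≡ (q + 14) / 16
    y/16≡ = digit≤1⇒/16≡ last≤1 (/-monoˡ-≤ P i≤x) (≤-trans y≤q+7 (+-monoʳ-≤ q (≤ᵇ⇒≤ 7 14 tt)))
    x≡ : x ≡ r + base (y % 16)
    x≡ = begin
      x                                 ≡⟨ m≡m%n+[m/n]*n x P ⟩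
      r + y * P                         ≡⟨ cong (λ z → r + z * P) (m≡m%n+[m/n]*n y 16) ⟩
      r + (y % 16 + y / 16 * 16) * P    ≡⟨ cong (λ z → r + (y % 16 + z * 16) * P) y/16≡ ⟩
      r + base (y % 16)                 ∎
      where open ≡-Reasoning

uncovered-block-empty : ∀ {i m p₁ p₂} .{{_ : NonZero m}} → OnesWithin i m p₁ p₂ →
  (a : Fin 6) → Uncovered ((p₁ ∸ i) / m) ((p₂ ∸ i) / m) (toℕ a) →
  ∀ {t} → t < m → digits≤1 (i + toℕ a * m + t) ≡ false
uncovered-block-empty {i} {m} ones⊆ a (free₁ , free₂) {t} t<m = ¬-not one⇒⊥
  where
  x = i + toℕ a * m + t
  i≤x : i ≤ x
  i≤x = ≤-trans (m≤m+n i (toℕ a * m)) (m≤m+n (i + toℕ a * m) t)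
  x<i+6m : x < i + 6 * m
  x<i+6m = begin-strict
    i + toℕ a * m + t   ≡⟨ +-assoc i (toℕ a * m) t ⟩
    i + (toℕ a * m + t) <⟨ +-monoʳ-< i (+-monoʳ-< (toℕ a * m) t<m) ⟩
    i + (toℕ a * m + m) ≡⟨ cong (i +_) (+-comm (toℕ a * m) m) ⟩
    i + suc (toℕ a) * m ≤⟨ +-monoʳ-≤ i (*-monoˡ-≤ m (toℕ<n a)) ⟩
    i + 6 * m           ∎
    where open ≤-Reasoning
  in-block-a : ∀ {g} → Covers g ((x ∸ i) / m) → Covers g (toℕ a)
  in-block-a = subst (Covers _) (block-index {i} (toℕ a) t<m)
  one⇒⊥ : digits≤1 x ≢ true
  one⇒⊥ one with ones⊆ x i≤x x<i+6m one
  ... | inj₁ x∈I₁ = free₁ (in-block-a (Within⇒Covers i≤x x∈I₁))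
  ... | inj₂ x∈I₂ = free₂ (in-block-a (Within⇒Covers i≤x x∈I₂))

bit : Bool → Fin 2
bit false = zero
bit true  = suc zero

sparse16 : Word (Fin 2)
sparse16 x = bit (digits≤1 x)

sparse16-recurrent : Recurrent sparse16
sparse16-recurrent i n N with power-above (i + n + N)
... | K , i+n+N<P = i + P , N<i+P , λ t t<n →
  cong bit (trans (cong digits≤1 (xy∙z≈xz∙y i P t)) (digits≤1-shift K (i+t<P t<n)))
  where
  P = 16 ^ K
  N<i+P : N < i + P
  N<i+P = ≤-trans (≤-<-trans (m≤n+m N (i + n)) i+n+N<P) (m≤n+m P i)
  i+t<P : ∀ {t} → t < n → i + t < P
  i+t<P t<n = ≤-<-trans (+-monoʳ-≤ i (<⇒≤ t<n)) (≤-<-trans (m≤m+n (i + n) N) i+n+N<P)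

sparse16-aperiodic : Aperiodic sparse16
sparse16-aperiodic (zero , _ , () , _)
sparse16-aperiodic (p@(suc _) , N , _ , periodic) with power-above (N + p)
... | K , N+p<P = one≢zero (trans (sym (cong bit (digits≤1-power (suc K))))
                                  (zero-beyond-2P (16 ^ suc K) 2P≤16P))
  where
  P = 16 ^ K
  one≢zero : bit true ≢ bit false
  one≢zero ()
  gap : ∀ t → t < p → sparse16 (2 * P + t) ≡ bit false
  gap t t<p = cong bit (trans (cong digits≤1 (+-comm (2 * P) t))
    (digits≤1-gap K (<-trans t<p (≤-<-trans (m≤n+m p N) N+p<P))))
  zero-beyond-2P : ∀ n → 2 * P ≤ n → sparse16 n ≡ bit false
  zero-beyond-2P = periodic-window⇒constant periodic
    (≤-trans (<⇒≤ (≤-<-trans (m≤m+n N p) N+p<P)) (m≤m+n P _)) gap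
  2P≤16P : 2 * P ≤ 16 * P
  2P≤16P = *-monoˡ-≤ P (≤ᵇ⇒≤ 2 16 tt)

OnesWithin⇒¬AntiPower : ∀ {i m p₁ p₂} .{{_ : NonZero m}} → OnesWithin i m p₁ p₂ →
  ¬ AntiPowerAt 6 sparse16 i m
OnesWithin⇒¬AntiPower {i} {m} {p₁} {p₂} ones⊆ (_ , distinct)
  with twoUncoveredBlocks ((p₁ ∸ i) / m) ((p₂ ∸ i) / m)
... | a , b , a<b , free-a , free-b with distinct a b a<b
... | t , t<m , differ = differ (cong bit
  (trans (uncovered-block-empty ones⊆ a free-a t<m) (sym (uncovered-block-empty ones⊆ b free-b t<m))))

sparse16-avoids-6-anti-powers : AvoidsAntiPowers 6 sparse16
sparse16-avoids-6-anti-powers i zero       (() , _)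
sparse16-avoids-6-anti-powers i m@(suc _) anti@(1≤m , _) =
  OnesWithin⇒¬AntiPower (proj₂ (proj₂ (ones-in-two-intervals i m 1≤m))) anti

proposition13 : Σ ℕ λ k → Σ (Word (Fin k)) λ w →
    Aperiodic w × Recurrent w × AvoidsAntiPowers 6 w
proposition13 = 2 , sparse16 , sparse16-aperiodic , sparse16-recurrent , sparse16-avoids-6-anti-powers
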